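{- $\chi_{CF}(\mathsf{I}^2_n)=\Omega(\sqrt{n})$ as $n\to\infty$.
   Context: A conflict-free coloring (CF-coloring) of a hypergraph $(V,\mathcal{E})$ is a map $\varphi$ on $V$ such that every nonempty hyperedge $e$ contains a vertex $x$ with $\varphi(y)\ne\varphi(x)$ for all $y\in e\setminus\{x\}$; $\chi_{CF}(H)$ is the least number of colors in a CF-coloring of $H$. A (discrete) interval in $[n]$ is a subset of $[n]$ consisting of consecutive integers. The 2-interval hypergraph $\mathsf{I}^2_n$ has vertex set $[n]$ and hyperedges all sets $I_1\cup I_2$ where $I_1,I_2\subseteq[n]$ are intervals and $|I_1\cup I_2|\ge 3$. -}

module Defs where

open import Data.Nat using (ℕ; _≤ᵇ_; _≤_; _*_)
open import Data.Bool using (_∧_)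
open import Data.Fin using (Fin; toℕ)
open import Data.Fin.Subset using (Subset; _∈_; _∪_; ∣_∣)
open import Data.Vec using (tabulate)
open import Data.Product using (Σ; _×_; ∃)
open import Relation.Binary.PropositionalEquality using (_≡_; _≢_)

-- Vertex set [n] is represented by Fin n (vertex i ↔ integer i+1).
-- The discrete interval {a, a+1, ..., b} ⊆ [n] (empty if a > b).
interval : ∀ {n} → Fin n → Fin n → Subset n
interval a b = tabulate (λ x → (toℕ a ≤ᵇ toℕ x) ∧ (toℕ x ≤ᵇ toℕ b))

IsEdge-I2 : ∀ {n} → Subset n → Set
IsEdge-I2 {n} e =
  Σ (Fin n) λ a₁ → Σ (Fin n) λ b₁ → Σ (Fin n) λ a₂ → Σ (Fin n) λ b₂ →
    (e ≡ interval a₁ b₁ ∪ interval a₂ b₂) × (3 ≤ ∣ e ∣)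

HasUniqueColour : ∀ {n k} → (Fin n → Fin k) → Subset n → Set
HasUniqueColour {n} φ e =
  Σ (Fin n) λ x → (x ∈ e) × (∀ y → y ∈ e → y ≢ x → φ y ≢ φ x)

IsCFColouring-I2 : ∀ {n k} → (Fin n → Fin k) → Set
IsCFColouring-I2 {n} φ = ∀ (e : Subset n) → IsEdge-I2 e → HasUniqueColour φ e

-- Split [n] into consecutive dominoes {2i, 2i+1}. If n ≥ 2(k² + 1), two of
-- the first k² + 1 dominoes receive the same ordered pair of colours, and the
-- union of these two intervals is a hyperedge of size 4 in which every colour
-- occurs exactly twice. Hence every CF-colouring with k colours has
-- n ≤ 2k² + 1.
module Submission where

open import Defs
open import Data.Nat using (ℕ; zero; suc; _≤_; _<_; _*_; z≤n; s≤s; s≤s⁻¹; _≤?_)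
open import Data.Nat.Properties
  using (≤-refl; ≤-trans; ≤-antisym; ≤ᵇ⇒≤; ≤⇒≤ᵇ; <⇒≢; <-trans;
         m≤n⇒m<n∨m≡n; n≤1+n; ≰⇒>; suc-injective; *-suc; *-monoʳ-≤; +-monoˡ-≤)
open import Data.Fin as Fin using (Fin; toℕ; fromℕ<; combine)
open import Data.Fin.Properties using (toℕ-injective; toℕ-fromℕ<; toℕ<n; pigeonhole; combine-injective)
open import Data.Fin.Subset using (Subset; _∈_; _∪_; ∣_∣; _-_)
open import Data.Fin.Subset.Properties using (x∈p⇒∣p-x∣<∣p∣; x∈p∧x≢y⇒x∈p-y; x∈p∪q⁻; p⊆p∪q; q⊆p∪q)
open import Data.Vec.Properties using (lookup∘tabulate; lookup⇒[]=; []=⇒lookup)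
open import Data.Bool.Properties using (T-≡; T-∧)
open import Data.Product using (Σ; _×_; _,_; proj₁; proj₂; ∃₂)
open import Data.Sum using (_⊎_; inj₁; inj₂)
open import Data.Empty using (⊥-elim)
open import Function using (_∘_)
open import Relation.Nullary using (¬_; yes; no)
open import Relation.Binary.PropositionalEquality using (_≡_; _≢_; refl; sym; trans; cong; subst; subst₂)
open import Function.Bundles using (Equivalence)

module _ {n : ℕ} where

  ∈-interval⁺ : ∀ {a b x : Fin n} → toℕ a ≤ toℕ x → toℕ x ≤ toℕ b → x ∈ interval a b
  ∈-interval⁺ {a} {b} {x} a≤x x≤b = lookup⇒[]= x (interval a b)
    (trans (lookup∘tabulate _ x)
      (Equivalence.to T-≡ (Equivalence.from T-∧ (≤⇒≤ᵇ a≤x , ≤⇒≤ᵇ x≤b))))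

  ∈-interval⁻ : ∀ {a b x : Fin n} → x ∈ interval a b → toℕ a ≤ toℕ x × toℕ x ≤ toℕ b
  ∈-interval⁻ {a} {b} {x} x∈ab
    with a≤ᵇx , x≤ᵇb ← Equivalence.to T-∧ (Equivalence.from T-≡
           (trans (sym (lookup∘tabulate _ x)) ([]=⇒lookup x∈ab)))
    = ≤ᵇ⇒≤ _ _ a≤ᵇx , ≤ᵇ⇒≤ _ _ x≤ᵇb

  ∈-interval-suc⁺ : ∀ {a b : Fin n} → toℕ b ≡ suc (toℕ a) → a ∈ interval a b × b ∈ interval a b
  ∈-interval-suc⁺ {a} b≡1+a = ∈-interval⁺ ≤-refl a≤b , ∈-interval⁺ a≤b ≤-refl
    where a≤b = subst (toℕ a ≤_) (sym b≡1+a) (n≤1+n (toℕ a))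

  ∈-interval-suc⁻ : ∀ {a b x : Fin n} → toℕ b ≡ suc (toℕ a) →
                    x ∈ interval a b → x ≡ a ⊎ x ≡ b
  ∈-interval-suc⁻ {a} {b} {x} b≡1+a x∈ab with a≤x , x≤b ← ∈-interval⁻ x∈ab
    with m≤n⇒m<n∨m≡n x≤b
  ... | inj₂ x≡b = inj₂ (toℕ-injective x≡b)
  ... | inj₁ x<b = inj₁ (toℕ-injective (≤-antisym (s≤s⁻¹ (subst (toℕ x <_) b≡1+a x<b)) a≤x))

  3≤∣p∣ : ∀ {p : Subset n} {a b c : Fin n} → a ∈ p → b ∈ p → c ∈ p →
          a ≢ b → a ≢ c → b ≢ c → 3 ≤ ∣ p ∣
  3≤∣p∣ {p} {a} {b} {c} a∈p b∈p c∈p a≢b a≢c b≢c =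
    ≤-trans (s≤s (≤-trans (s≤s (≤-trans (s≤s z≤n) (x∈p⇒∣p-x∣<∣p∣ c∈p-a-b)))
                          (x∈p⇒∣p-x∣<∣p∣ b∈p-a)))
            (x∈p⇒∣p-x∣<∣p∣ a∈p)
    where
    b∈p-a : b ∈ p - a
    b∈p-a = x∈p∧x≢y⇒x∈p-y b∈p (λ b≡a → a≢b (sym b≡a))
    c∈p-a-b : c ∈ p - a - b
    c∈p-a-b = x∈p∧x≢y⇒x∈p-y (x∈p∧x≢y⇒x∈p-y c∈p (λ c≡a → a≢c (sym c≡a)))
                             (λ c≡b → b≢c (sym c≡b))

module _ {n k : ℕ} (φ : Fin n → Fin k) where

  ColoursRepeatedIn : Subset n → Subset n → Set
  ColoursRepeatedIn P Q = ∀ x → x ∈ P → Σ (Fin n) λ y → y ∈ Q × y ≢ x × φ y ≡ φ x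

  ¬HasUniqueColour-∪ : ∀ {P Q} → ColoursRepeatedIn P Q → ColoursRepeatedIn Q P →
                       ¬ HasUniqueColour φ (P ∪ Q)
  ¬HasUniqueColour-∪ {P} {Q} P→Q Q→P (x , x∈P∪Q , unique) with x∈p∪q⁻ P Q x∈P∪Q
  ... | inj₁ x∈P with y , y∈Q , y≢x , φy≡φx ← P→Q x x∈P = unique y (q⊆p∪q P Q y∈Q) y≢x φy≡φx
  ... | inj₂ x∈Q with y , y∈P , y≢x , φy≡φx ← Q→P x x∈Q = unique y (p⊆p∪q Q y∈P) y≢x φy≡φx

  dominoes-repeat : ∀ {a b a' b' : Fin n} → toℕ b ≡ suc (toℕ a) → toℕ b' ≡ suc (toℕ a') →
                    a ≢ a' → φ a ≡ φ a' → φ b ≡ φ b' →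
                    ColoursRepeatedIn (interval a b) (interval a' b')
  dominoes-repeat {a} {b} {a'} {b'} b≡1+a b'≡1+a' a≢a' φa≡φa' φb≡φb' x x∈ab
    with ∈-interval-suc⁻ b≡1+a x∈ab
  ... | inj₁ refl = a' , proj₁ (∈-interval-suc⁺ b'≡1+a') , (λ a'≡a → a≢a' (sym a'≡a)) , sym φa≡φa'
  ... | inj₂ refl = b' , proj₂ (∈-interval-suc⁺ b'≡1+a') , b'≢b , sym φb≡φb'
    where
    b'≢b : b' ≢ b
    b'≢b b'≡b = a≢a' (toℕ-injective (suc-injective
      (trans (sym b≡1+a) (trans (cong toℕ (sym b'≡b)) b'≡1+a'))))

  twinDominoes⇒¬CF : ∀ {a b a' b' : Fin n} → toℕ b ≡ suc (toℕ a) → toℕ b' ≡ suc (toℕ a') →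
                     toℕ b < toℕ a' → φ a ≡ φ a' → φ b ≡ φ b' → ¬ IsCFColouring-I2 φ
  twinDominoes⇒¬CF {a} {b} {a'} {b'} b≡1+a b'≡1+a' b<a' φa≡φa' φb≡φb' cf =
    ¬HasUniqueColour-∪
      (dominoes-repeat b≡1+a b'≡1+a' a≢a' φa≡φa' φb≡φb')
      (dominoes-repeat b'≡1+a' b≡1+a (λ a'≡a → a≢a' (sym a'≡a)) (sym φa≡φa') (sym φb≡φb'))
      (cf edge (a , b , a' , b' , refl , 3≤∣edge∣))
    where
    edge = interval a b ∪ interval a' b'
    a<b : toℕ a < toℕ b
    a<b = subst (toℕ a <_) (sym b≡1+a) ≤-refl
    a≢a' : a ≢ a'
    a≢a' = <⇒≢ (<-trans a<b b<a') ∘ cong toℕ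
    3≤∣edge∣ : 3 ≤ ∣ edge ∣
    3≤∣edge∣ = 3≤∣p∣
      (p⊆p∪q _ (proj₁ (∈-interval-suc⁺ b≡1+a)))
      (p⊆p∪q _ (proj₂ (∈-interval-suc⁺ b≡1+a)))
      (q⊆p∪q _ _ (proj₁ (∈-interval-suc⁺ b'≡1+a')))
      (<⇒≢ a<b ∘ cong toℕ) a≢a' (<⇒≢ b<a' ∘ cong toℕ)

pigeonhole₂ : ∀ {m k l} → k * l < m → (f : Fin m → Fin k) (g : Fin m → Fin l) →
              ∃₂ λ i j → i Fin.< j × f i ≡ f j × g i ≡ g j
pigeonhole₂ k*l<m f g with i , j , i<j , fgi≡fgj ← pigeonhole k*l<m (λ i → combine (f i) (g i))
  = i , j , i<j , combine-injective _ _ _ _ fgi≡fgj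

m<n⇒1+2m<2n : ∀ {m n} → m < n → suc (2 * m) < 2 * n
m<n⇒1+2m<2n {m} {n} m<n = subst (_≤ 2 * n) (*-suc 2 m) (*-monoʳ-≤ 2 m<n)

module Dominoes {n m : ℕ} (dominoes-fit : 2 * m ≤ n) where

  hi-fits : (i : Fin m) → suc (2 * toℕ i) < n
  hi-fits i = ≤-trans (m<n⇒1+2m<2n (toℕ<n i)) dominoes-fit

  lo hi : Fin m → Fin n
  lo i = fromℕ< (<-trans ≤-refl (hi-fits i))
  hi i = fromℕ< (hi-fits i)

  hi≡1+lo : ∀ i → toℕ (hi i) ≡ suc (toℕ (lo i))
  hi≡1+lo i = trans (toℕ-fromℕ< _) (cong suc (sym (toℕ-fromℕ< _)))

  hi<lo : ∀ {i j} → i Fin.< j → toℕ (hi i) < toℕ (lo j)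
  hi<lo i<j = subst₂ _<_ (sym (toℕ-fromℕ< _)) (sym (toℕ-fromℕ< _)) (m<n⇒1+2m<2n i<j)

module _ {n k : ℕ} (φ : Fin n → Fin k) (dominoes-fit : 2 * suc (k * k) ≤ n) where
  open Dominoes {m = suc (k * k)} dominoes-fit

  2[1+k²]≤n⇒¬CF : ¬ IsCFColouring-I2 φ
  2[1+k²]≤n⇒¬CF
    with i , j , i<j , φlo≡ , φhi≡ ← pigeonhole₂ (≤-refl {suc (k * k)}) (φ ∘ lo) (φ ∘ hi)
    = twinDominoes⇒¬CF φ (hi≡1+lo i) (hi≡1+lo j) (hi<lo i<j) φlo≡ φhi≡

CF-I2-bound : ∀ {n k} (φ : Fin n → Fin k) → IsCFColouring-I2 φ → n ≤ suc (2 * (k * k))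
CF-I2-bound {n} {k} φ cf with n ≤? suc (2 * (k * k))
... | yes n≤1+2k² = n≤1+2k²
... | no n≰1+2k² = ⊥-elim (2[1+k²]≤n⇒¬CF φ (subst (_≤ n) (sym (*-suc 2 (k * k))) (≰⇒> n≰1+2k²)) cf)

proposition3p1 : Σ ℕ λ C → Σ ℕ λ N → ∀ (n : ℕ) → N ≤ n → ∀ (k : ℕ) → (φ : Fin n → Fin k) → IsCFColouring-I2 φ → n ≤ suc C * (k * k)
proposition3p1 = 2 , 0 , bound
  where
  bound : ∀ n → 0 ≤ n → ∀ k (φ : Fin n → Fin k) → IsCFColouring-I2 φ → n ≤ 3 * (k * k)
  bound zero    _ _       _ _  = z≤n
  bound (suc n) _ zero    φ _  with () ← φ Fin.zero
  bound (suc n) _ (suc k) φ cf =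
    ≤-trans (CF-I2-bound φ cf) (+-monoˡ-≤ (2 * (suc k * suc k)) (s≤s z≤n))
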